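{- Let $w\in S_n$ be fireworks, and let $\mathrm{rajcode}(w)=(r_1,\ldots,r_n)$. Then $r_n=0$, and for $i<n$, $r_i=r_{i+1}$ if $w(i)<w(i+1)$ and $r_i=r_{i+1}+1$ if $w(i)>w(i+1)$.
   Context: Permutations are written in one-line notation. The decreasing runs of $w$ are the maximal blocks of consecutive positions on which $w(1)\cdots w(n)$ is decreasing; $w$ is fireworks if the first elements of its decreasing runs occur in increasing order. The Rajchgot code of $w\in S_n$ is $\mathrm{rajcode}(w)=(r_1,\ldots,r_n)$, where for each $j$ one chooses an increasing subsequence of $w(j),w(j+1),\ldots,w(n)$ that contains $w(j)$ and has greatest length among all such subsequences, and $r_j$ is the number of terms of $w(j),\ldots,w(n)$ omitted to form it. -}

module Defs where

open import Data.Nat using (ℕ; _∸_)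
open import Data.Fin using (Fin; toℕ; _<_; _≤_)
open import Data.Fin.Permutation using (Permutation′; _⟨$⟩ʳ_)
open import Data.List using (List; length; map)
open import Data.List.Relation.Unary.All using (All)
open import Data.List.Relation.Unary.Linked using (Linked)
open import Data.List.Membership.Propositional using (_∈_)
open import Data.Product using (_×_; ∃)
open import Relation.Binary.PropositionalEquality using (_≡_)
open import Relation.Nullary using (¬_)

-- Conventions: positions and values are 0-indexed (Fin n); the one-line
-- notation of w is  w ⟨$⟩ʳ 0, …, w ⟨$⟩ʳ (n-1).

record DecRun {n : ℕ} (w : Permutation′ n) (a b : Fin n) : Set where
  field
    ordered  : a ≤ b
    decr     : ∀ (i j : Fin n) → a ≤ i → j ≤ b → toℕ j ≡ ℕ.suc (toℕ i) →
               (w ⟨$⟩ʳ j) < (w ⟨$⟩ʳ i)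
    maxLeft  : ∀ (i : Fin n) → toℕ a ≡ ℕ.suc (toℕ i) → ¬ ((w ⟨$⟩ʳ a) < (w ⟨$⟩ʳ i))
    maxRight : ∀ (j : Fin n) → toℕ j ≡ ℕ.suc (toℕ b) → ¬ ((w ⟨$⟩ʳ j) < (w ⟨$⟩ʳ b))

Fireworks : {n : ℕ} → Permutation′ n → Set
Fireworks {n} w = ∀ (a b c d : Fin n) → DecRun w a b → DecRun w c d → a < c →
                  (w ⟨$⟩ʳ a) < (w ⟨$⟩ʳ c)

record IncSubseqFrom {n : ℕ} (w : Permutation′ n) (j : Fin n) (ps : List (Fin n)) : Set where
  field
    positionsIncr : Linked _<_ ps
    positionsFrom : All (j ≤_) ps
    containsJ     : j ∈ ps
    valuesIncr    : Linked _<_ (map (w ⟨$⟩ʳ_) ps)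

IsRajcode : {n : ℕ} → Permutation′ n → (Fin n → ℕ) → Set
IsRajcode {n} w r = ∀ (j : Fin n) →
  ∃ λ ps → IncSubseqFrom w j ps
         × (∀ qs → IncSubseqFrom w j qs → length qs Data.Nat.≤ length ps)
         × r j ≡ (n ∸ toℕ j) ∸ length ps

{-# OPTIONS --safe #-}
-- Write A(j) for the number of ascents w(k) < w(k+1) with j ≤ k.  Between two consecutive terms
-- of an increasing subsequence there is always an ascent, so an increasing subsequence starting
-- at j has length at most 1 + A(j).  For a fireworks permutation this bound is attained by w(j)
-- followed by the tops w(k+1) of those ascents: each top is the first element of a decreasing
-- run, first elements of runs increase, and every entry is at most the first element of its
-- own run.  Hence r_j, the number of terms from w(j) on minus 1 + A(j), counts the descents
-- at positions ≥ j, which is the claimed recurrence.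
module Submission where

open import Defs
open import Data.Nat
  using (ℕ; zero; suc; _+_; _∸_; _≤_; _≤′_; _<?_; z≤n; s≤s; ≤′-refl; ≤′-step)
open import Data.Nat.Properties
  using (≤-refl; ≤-reflexive; ≤-trans; ≤-antisym; <-trans; ≤-<-trans; <-irrefl; <-asym;
         <⇒≤; ≮⇒≥; ≤⇒≤′; ≤′⇒≤; n≤1+n; n<1+n; m≤n⇒m≤1+n; m≤n+m; m≤n+m∸n;
         +-suc; m∸n+n≡m; +-∸-assoc; ∸-+-assoc; m≤n⇒m∸n≡0; 0∸n≡0)
open import Data.Fin using (Fin; toℕ; fromℕ<)
open import Data.Fin.Properties using (toℕ<n; toℕ-fromℕ<; fromℕ<-toℕ)
open import Data.Fin.Permutation using (Permutation′; _⟨$⟩ʳ_)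
open import Data.List using (List; []; _∷_; length; map)
open import Data.List.Properties using (length-map)
open import Data.List.Relation.Unary.All as All using (All; []; _∷_)
import Data.List.Relation.Unary.All.Properties as All
open import Data.List.Relation.Unary.Any using (here)
open import Data.List.Relation.Unary.Linked using (Linked; []; [-]; _∷_)
import Data.List.Relation.Unary.Linked.Properties as Linked
open import Data.Product using (_×_; _,_; ∃; ∃₂)
open import Data.Empty using (⊥)
open import Function using (_∘_)
open import Relation.Nullary using (¬_; yes; no; contradiction)
open import Relation.Binary.PropositionalEquality
  using (_≡_; refl; sym; trans; cong; cong₂; subst; subst₂; module ≡-Reasoning)

-- The theorem is stated with Data.Fin's _<_, so the order on ℕ is opened only locally.
module _ where

  open import Data.Nat using (_<_)

  <-head : ∀ {x y xs} → x < y → Linked _<_ (y ∷ xs) → Linked _<_ (x ∷ xs)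
  <-head x<y [-]         = [-]
  <-head x<y (y<z ∷ y∷z) = <-trans x<y y<z ∷ y∷z

  head≤ : ∀ {x xs} → Linked _<_ (x ∷ xs) → All (x ≤_) (x ∷ xs)
  head≤ [-]       = ≤-refl ∷ []
  head≤ (x<y ∷ l) = ≤-refl ∷ All.map <⇒≤ (Linked.Linked⇒All <-trans x<y l)

module Sequence (n : ℕ) (f : ℕ → ℕ) where

  open import Data.Nat using (_<_)

  Ascent : ℕ → Set
  Ascent m = f m < f (suc m)

  AscentTop : ℕ → Set
  AscentTop zero    = ⊥
  AscentTop (suc m) = Ascent m

  ascentTops : ℕ → ℕ → List ℕ
  ascentTops zero    m = []
  ascentTops (suc t) m with f m <? f (suc m)
  ... | yes _ = suc m ∷ ascentTops t (suc m)
  ... | no  _ = ascentTops t (suc m)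

  ascentTops-ascent : ∀ {t m} → Ascent m → ascentTops (suc t) m ≡ suc m ∷ ascentTops t (suc m)
  ascentTops-ascent {m = m} asc with f m <? f (suc m)
  ... | yes _    = refl
  ... | no  ¬asc = contradiction asc ¬asc

  ascentTops-¬ascent : ∀ {t m} → ¬ Ascent m → ascentTops (suc t) m ≡ ascentTops t (suc m)
  ascentTops-¬ascent {m = m} ¬asc with f m <? f (suc m)
  ... | yes asc = contradiction asc ¬asc
  ... | no  _   = refl

  length-ascentTops≤ : ∀ t m → length (ascentTops t m) ≤ t
  length-ascentTops≤ zero    m = z≤n
  length-ascentTops≤ (suc t) m with f m <? f (suc m)
  ... | yes _ = s≤s (length-ascentTops≤ t (suc m))
  ... | no  _ = m≤n⇒m≤1+n (length-ascentTops≤ t (suc m))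

  ascentTops-linked : ∀ t m → Linked _<_ (m ∷ ascentTops t m)
  ascentTops-linked zero    m = [-]
  ascentTops-linked (suc t) m with f m <? f (suc m)
  ... | yes _ = n<1+n m ∷ ascentTops-linked t (suc m)
  ... | no  _ = <-head (n<1+n m) (ascentTops-linked t (suc m))

  ascentTops-bounded : ∀ t m → All (_≤ t + m) (ascentTops t m)
  ascentTops-bounded zero    m = []
  ascentTops-bounded (suc t) m rewrite sym (+-suc t m) with f m <? f (suc m)
  ... | yes _ = m≤n+m (suc m) t ∷ ascentTops-bounded t (suc m)
  ... | no  _ = ascentTops-bounded t (suc m)

  ascentTops-ascentTop : ∀ t m → All AscentTop (ascentTops t m)
  ascentTops-ascentTop zero    m = []
  ascentTops-ascentTop (suc t) m with f m <? f (suc m)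
  ... | yes asc = asc ∷ ascentTops-ascentTop t (suc m)
  ... | no  _   = ascentTops-ascentTop t (suc m)

  -- The scan from m up to the last position n ∸ 1 takes n ∸ suc m steps.
  ascentTopsFrom : ℕ → List ℕ
  ascentTopsFrom m = ascentTops (n ∸ suc m) m

  ascentsFrom : ℕ → ℕ
  ascentsFrom m = length (ascentTopsFrom m)

  nonAscentsFrom : ℕ → ℕ
  nonAscentsFrom m = (n ∸ suc m) ∸ ascentsFrom m

  scan-length : ∀ {m} → m < n → suc (n ∸ suc m + m) ≡ n
  scan-length {m} m<n = trans (sym (+-suc (n ∸ suc m) m)) (m∸n+n≡m m<n)

  scan-suc : ∀ {m} → suc m < n → n ∸ suc m ≡ suc (n ∸ suc (suc m))
  scan-suc = +-∸-assoc 1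

  ascentsFrom-ascent : ∀ {m} → suc m < n → Ascent m → ascentsFrom m ≡ suc (ascentsFrom (suc m))
  ascentsFrom-ascent sm<n asc rewrite scan-suc sm<n = cong length (ascentTops-ascent asc)

  ascentsFrom-¬ascent : ∀ {m} → suc m < n → ¬ Ascent m → ascentsFrom m ≡ ascentsFrom (suc m)
  ascentsFrom-¬ascent sm<n ¬asc rewrite scan-suc sm<n = cong length (ascentTops-¬ascent ¬asc)

  ascentsFrom-last : ∀ {m} → n ≤ suc m → ascentsFrom m ≡ 0
  ascentsFrom-last n≤sm rewrite m≤n⇒m∸n≡0 n≤sm = refl

  ascentsFrom-suc≤ : ∀ m → ascentsFrom (suc m) ≤ ascentsFrom m
  ascentsFrom-suc≤ m with suc m <? n
  ... | no sm≮n = subst (_≤ ascentsFrom m) (sym (ascentsFrom-last (m≤n⇒m≤1+n (≮⇒≥ sm≮n)))) z≤n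
  ... | yes sm<n with f m <? f (suc m)
  ...   | yes asc = ≤-trans (n≤1+n _) (≤-reflexive (sym (ascentsFrom-ascent sm<n asc)))
  ...   | no ¬asc = ≤-reflexive (sym (ascentsFrom-¬ascent sm<n ¬asc))

  ascentsFrom-antitone : ∀ {p q} → p ≤ q → ascentsFrom q ≤ ascentsFrom p
  ascentsFrom-antitone = antitone ∘ ≤⇒≤′
    where
    antitone : ∀ {p q} → p ≤′ q → ascentsFrom q ≤ ascentsFrom p
    antitone ≤′-refl        = ≤-refl
    antitone (≤′-step p≤′q) = ≤-trans (ascentsFrom-suc≤ _) (antitone p≤′q)

  -- An increase from p to q forces an ascent somewhere in [p, q).
  ascentsFrom-increase : ∀ {p q} → p < q → q < n → f p < f q → suc (ascentsFrom q) ≤ ascentsFrom p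
  ascentsFrom-increase p<q = increase (≤⇒≤′ p<q)
    where
    increase : ∀ {p q} → suc p ≤′ q → q < n → f p < f q → suc (ascentsFrom q) ≤ ascentsFrom p
    increase ≤′-refl q<n asc = ≤-reflexive (sym (ascentsFrom-ascent q<n asc))
    increase {p} {suc q} (≤′-step sp≤′q) sq<n fp<fsq with f q <? f (suc q)
    ... | yes asc =
      subst (_≤ _) (ascentsFrom-ascent sq<n asc)
            (ascentsFrom-antitone (≤-trans (n≤1+n p) (≤′⇒≤ sp≤′q)))
    ... | no ¬asc =
      ≤-trans (s≤s (ascentsFrom-suc≤ q))
              (increase sp≤′q (<-trans (n<1+n q) sq<n) (≤-trans fp<fsq (≮⇒≥ ¬asc)))

  increasing-length≤ : ∀ {p ps} → Linked _<_ (p ∷ ps) → Linked _<_ (map f (p ∷ ps)) →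
                       All (_< n) ps → length ps ≤ ascentsFrom p
  increasing-length≤ {ps = []}    _             _               _          = z≤n
  increasing-length≤ {ps = _ ∷ _} (p<q ∷ p∷ps) (fp<fq ∷ fp∷fps) (q<n ∷ ps<n) =
    ≤-trans (s≤s (increasing-length≤ p∷ps fp∷fps ps<n)) (ascentsFrom-increase p<q q<n fp<fq)

  Dominant : Set
  Dominant = ∀ {m h} → m < h → h < n → AscentTop h → f m < f h

  dominant⇒increasing : Dominant → ∀ {p ps} → Linked _<_ (p ∷ ps) → All (_< n) ps →
                        All AscentTop ps → Linked _<_ (map f (p ∷ ps))
  dominant⇒increasing dom [-]           []           []           = [-]
  dominant⇒increasing dom (p<q ∷ q∷ps) (q<n ∷ ps<n) (top ∷ tops) =
    dom p<q q<n top ∷ dominant⇒increasing dom q∷ps ps<n tops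

  ascentTopsFrom-bounded : ∀ {m} → m < n → All (_< n) (ascentTopsFrom m)
  ascentTopsFrom-bounded {m} m<n =
    All.map (λ h≤ → ≤-trans (s≤s h≤) (≤-reflexive (scan-length m<n)))
            (ascentTops-bounded (n ∸ suc m) m)

  ascentTopsFrom-increasing : Dominant → ∀ {m} → m < n → Linked _<_ (map f (m ∷ ascentTopsFrom m))
  ascentTopsFrom-increasing dom {m} m<n =
    dominant⇒increasing dom (ascentTops-linked (n ∸ suc m) m) (ascentTopsFrom-bounded m<n)
      (ascentTops-ascentTop (n ∸ suc m) m)

  nonAscentsFrom-last : ∀ {m} → n ≤ suc m → nonAscentsFrom m ≡ 0
  nonAscentsFrom-last {m} n≤sm =
    trans (cong (_∸ ascentsFrom m) (m≤n⇒m∸n≡0 n≤sm)) (0∸n≡0 (ascentsFrom m))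

  nonAscentsFrom-ascent : ∀ {m} → suc m < n → Ascent m → nonAscentsFrom m ≡ nonAscentsFrom (suc m)
  nonAscentsFrom-ascent sm<n asc = cong₂ _∸_ (scan-suc sm<n) (ascentsFrom-ascent sm<n asc)

  nonAscentsFrom-¬ascent : ∀ {m} → suc m < n → ¬ Ascent m →
                           nonAscentsFrom m ≡ suc (nonAscentsFrom (suc m))
  nonAscentsFrom-¬ascent {m} sm<n ¬asc =
    trans (cong₂ _∸_ (scan-suc sm<n) (ascentsFrom-¬ascent sm<n ¬asc))
          (+-∸-assoc 1 (length-ascentTops≤ (n ∸ suc (suc m)) (suc m)))

  Descending : ℕ → ℕ → Set
  Descending a b = ∀ {m} → a ≤ m → m < b → f (suc m) < f m

  descending-empty : ∀ {a} → Descending a a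
  descending-empty a≤m m<a = contradiction (≤-<-trans a≤m m<a) (<-irrefl refl)

  descending-step : ∀ {a} → f (suc a) < f a → Descending a (suc a)
  descending-step {a} desc a≤m (s≤s m≤a) = subst (λ k → f (suc k) < f k) (≤-antisym a≤m m≤a) desc

  descending-join : ∀ {a b c} → Descending a b → Descending b c → Descending a c
  descending-join {b = b} ab bc {m} a≤m m<c with m <? b
  ... | yes m<b = ab a≤m m<b
  ... | no  m≮b = bc (≮⇒≥ m≮b) m<c

  descending-≤ : ∀ {a b m} → Descending a b → a ≤ m → m ≤ b → f m ≤ f a
  descending-≤ {a} {b} desc a≤m = go (≤⇒≤′ a≤m)
    where
    go : ∀ {m} → a ≤′ m → m ≤ b → f m ≤ f a
    go ≤′-refl             _    = ≤-refl
    go (≤′-step a≤′m) sm≤b = ≤-trans (<⇒≤ (desc (≤′⇒≤ a≤′m) sm≤b)) (go a≤′m (<⇒≤ sm≤b))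

  MaximalLeft : ℕ → Set
  MaximalLeft a = ∀ {i} → a ≡ suc i → ¬ f a < f i

  MaximalRight : ℕ → Set
  MaximalRight b = suc b < n → ¬ f (suc b) < f b

  record Run (a b : ℕ) : Set where
    field
      a≤b        : a ≤ b
      b<n        : b < n
      descending : Descending a b
      maximalˡ   : MaximalLeft a
      maximalʳ   : MaximalRight b

    a<n : a < n
    a<n = ≤-<-trans a≤b b<n

  run-start : ∀ m → ∃ λ a → a ≤ m × Descending a m × MaximalLeft a
  run-start zero = zero , z≤n , descending-empty , λ ()
  run-start (suc m) with f (suc m) <? f m
  ... | no ¬desc = suc m , ≤-refl , descending-empty , λ { refl → ¬desc }
  ... | yes desc with run-start m
  ...   | a , a≤m , a⋯m , maxˡ =
    a , m≤n⇒m≤1+n a≤m , descending-join a⋯m (descending-step desc) , maxˡ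

  run-end : ∀ {m} → m < n → ∃ λ b → m ≤ b × b < n × Descending m b × MaximalRight b
  run-end {m} m<n = scan (n ∸ suc m) m (scan-length m<n)
    where
    scan : ∀ t m → suc (t + m) ≡ n → ∃ λ b → m ≤ b × b < n × Descending m b × MaximalRight b
    scan zero    m end =
      m , ≤-refl , ≤-reflexive end , descending-empty , λ sm<n → contradiction sm<n (<-irrefl end)
    scan (suc t) m end with f (suc m) <? f m
    ... | no ¬desc =
      m , ≤-refl , ≤-trans (s≤s (m≤n+m m (suc t))) (≤-reflexive end) , descending-empty ,
      λ _ → ¬desc
    ... | yes desc with scan t (suc m) (trans (cong suc (+-suc t m)) end)
    ...   | b , sm≤b , b<n , sm⋯b , maxʳ =
      b , <⇒≤ sm≤b , b<n , descending-join (descending-step desc) sm⋯b , maxʳ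

  run-containing : ∀ {m} → m < n → ∃₂ λ a b → a ≤ m × m ≤ b × Run a b
  run-containing {m} m<n with run-start m | run-end m<n
  ... | a , a≤m , a⋯m , maxˡ | b , m≤b , b<n , m⋯b , maxʳ =
    a , b , a≤m , m≤b , record
      { a≤b = ≤-trans a≤m m≤b ; b<n = b<n ; descending = descending-join a⋯m m⋯b
      ; maximalˡ = maxˡ ; maximalʳ = maxʳ }

  run-from-ascentTop : ∀ {h} → h < n → AscentTop h → ∃ (Run h)
  run-from-ascentTop {suc c} h<n asc with run-end h<n
  ... | b , h≤b , b<n , h⋯b , maxʳ =
    b , record
      { a≤b = h≤b ; b<n = b<n ; descending = h⋯b
      ; maximalˡ = λ { refl desc → <-asym asc desc } ; maximalʳ = maxʳ }

  RunStartsIncrease : Set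
  RunStartsIncrease = ∀ {a b c d} → Run a b → Run c d → a < c → f a < f c

  -- Every ascent top h starts a run; the run containing m < h starts at some a ≤ m, and f m ≤ f a.
  runStartsIncrease⇒dominant : RunStartsIncrease → Dominant
  runStartsIncrease⇒dominant increase m<h h<n top
    with run-containing (<-trans m<h h<n) | run-from-ascentTop h<n top
  ... | a , b , a≤m , m≤b , run | _ , run′ =
    ≤-<-trans (descending-≤ (Run.descending run) a≤m m≤b) (increase run run′ (≤-<-trans a≤m m<h))

module _ {n : ℕ} (w : Permutation′ n) where

  open import Data.Nat using (_<_)

  toℕ-surjective : ∀ {xs} → All (_< n) xs → ∃ λ (is : List (Fin n)) → map toℕ is ≡ xs
  toℕ-surjective []         = [] , refl
  toℕ-surjective (x<n ∷ xs) with toℕ-surjective xs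
  ... | is , refl = fromℕ< x<n ∷ is , cong (_∷ map toℕ is) (toℕ-fromℕ< x<n)

  -- Positions outside 0 … n ∸ 1 get the junk value 0.
  value : ℕ → ℕ
  value m with m <? n
  ... | yes m<n = toℕ (w ⟨$⟩ʳ fromℕ< m<n)
  ... | no  _   = 0

  open Sequence n value

  value-fromℕ< : ∀ {m} (m<n : m < n) → value m ≡ toℕ (w ⟨$⟩ʳ fromℕ< m<n)
  value-fromℕ< {m} m<n with m <? n
  ... | yes _   = refl
  ... | no  m≮n = contradiction m<n m≮n

  value-toℕ : ∀ i → value (toℕ i) ≡ toℕ (w ⟨$⟩ʳ i)
  value-toℕ i = trans (value-fromℕ< (toℕ<n i)) (cong (λ k → toℕ (w ⟨$⟩ʳ k)) (fromℕ<-toℕ i _))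

  value-next : ∀ {i j : Fin n} → toℕ j ≡ suc (toℕ i) → value (suc (toℕ i)) ≡ toℕ (w ⟨$⟩ʳ j)
  value-next {j = j} j≡si = trans (cong value (sym j≡si)) (value-toℕ j)

  values-toℕ : ∀ is → map value (map toℕ is) ≡ map toℕ (map (w ⟨$⟩ʳ_) is)
  values-toℕ []       = refl
  values-toℕ (i ∷ is) = cong₂ _∷_ (value-toℕ i) (values-toℕ is)

  toDecRun : ∀ {a b : Fin n} → Run (toℕ a) (toℕ b) → DecRun w a b
  toDecRun {a} {b} run = record
    { ordered  = a≤b
    ; decr     = λ i j a≤i j≤b j≡si →
        subst₂ _<_ (value-next j≡si) (value-toℕ i) (descending a≤i (subst (_≤ toℕ b) j≡si j≤b))
    ; maxLeft  = λ i a≡si →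
        maximalˡ a≡si ∘ subst₂ _<_ (sym (value-toℕ a)) (sym (value-toℕ i))
    ; maxRight = λ j j≡sb →
        maximalʳ (subst (_< n) j≡sb (toℕ<n j)) ∘ subst₂ _<_ (sym (value-next j≡sb)) (sym (value-toℕ b))
    }
    where open Run run

  toDecRun-fromℕ< : ∀ {a b} (run : Run a b) → DecRun w (fromℕ< (Run.a<n run)) (fromℕ< (Run.b<n run))
  toDecRun-fromℕ< run =
    toDecRun (subst₂ Run (sym (toℕ-fromℕ< (Run.a<n run))) (sym (toℕ-fromℕ< (Run.b<n run))) run)

  fireworks⇒runStartsIncrease : Fireworks w → RunStartsIncrease
  fireworks⇒runStartsIncrease fw run₁ run₂ a<c =
    subst₂ _<_ (sym (value-fromℕ< (Run.a<n run₁))) (sym (value-fromℕ< (Run.a<n run₂)))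
      (fw _ _ _ _ (toDecRun-fromℕ< run₁) (toDecRun-fromℕ< run₂)
        (subst₂ _<_ (sym (toℕ-fromℕ< (Run.a<n run₁))) (sym (toℕ-fromℕ< (Run.a<n run₂))) a<c))

  incSubseq-length≤ : ∀ {j ps} → IncSubseqFrom w j ps → length ps ≤ suc (ascentsFrom (toℕ j))
  incSubseq-length≤ {ps = []} record { containsJ = () }
  incSubseq-length≤ {j} {p ∷ ps} s = s≤s (≤-trans tail≤ (ascentsFrom-antitone j≤p))
    where
    open IncSubseqFrom s
    j≤p : toℕ j ≤ toℕ p
    j≤p = All.head positionsFrom
    tail≤ : length ps ≤ ascentsFrom (toℕ p)
    tail≤ = subst (_≤ _) (length-map toℕ ps)
      (increasing-length≤ (Linked.map⁺ positionsIncr)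
        (subst (Linked _<_) (sym (values-toℕ (p ∷ ps))) (Linked.map⁺ valuesIncr))
        (All.map⁺ (All.universal toℕ<n ps)))

  incSubseq-fromℕ : ∀ (j : Fin n) {xs} → All (_< n) xs → Linked _<_ (toℕ j ∷ xs) →
                    Linked _<_ (map value (toℕ j ∷ xs)) →
                    ∃ λ ps → IncSubseqFrom w j ps × length ps ≡ suc (length xs)
  incSubseq-fromℕ j xs<n positions values with toℕ-surjective xs<n
  ... | is , refl = j ∷ is , s , cong suc (sym (length-map toℕ is))
    where
    s : IncSubseqFrom w j (j ∷ is)
    s = record
      { positionsIncr = Linked.map⁻ positions
      ; positionsFrom = All.map⁻ (head≤ positions)
      ; containsJ     = here refl
      ; valuesIncr    = Linked.map⁻ (subst (Linked _<_) (values-toℕ (j ∷ is)) values)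
      }

  incSubseq-longest : Dominant → ∀ j →
                      ∃ λ ps → IncSubseqFrom w j ps × length ps ≡ suc (ascentsFrom (toℕ j))
  incSubseq-longest dom j =
    incSubseq-fromℕ j (ascentTopsFrom-bounded (toℕ<n j))
      (ascentTops-linked (n ∸ suc (toℕ j)) (toℕ j)) (ascentTopsFrom-increasing dom (toℕ<n j))

  rajcode≡nonAscentsFrom : Fireworks w → ∀ {r} → IsRajcode w r → ∀ j → r j ≡ nonAscentsFrom (toℕ j)
  rajcode≡nonAscentsFrom fw {r} rc j with rc j
  ... | ps , s , longest , r≡ = begin
    r j                                 ≡⟨ r≡ ⟩
    (n ∸ toℕ j) ∸ length ps             ≡⟨ cong ((n ∸ toℕ j) ∸_) length-ps ⟩
    (n ∸ toℕ j) ∸ suc A                 ≡⟨ ∸-+-assoc n (toℕ j) (suc A) ⟩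
    n ∸ (toℕ j + suc A)                 ≡⟨ cong (n ∸_) (+-suc (toℕ j) A) ⟩
    n ∸ suc (toℕ j + A)                 ≡⟨ sym (∸-+-assoc n (suc (toℕ j)) A) ⟩
    nonAscentsFrom (toℕ j)              ∎
    where
    open ≡-Reasoning
    A : ℕ
    A = ascentsFrom (toℕ j)
    length-ps : length ps ≡ suc A
    length-ps with incSubseq-longest (runStartsIncrease⇒dominant (fireworks⇒runStartsIncrease fw)) j
    ... | qs , t , length-qs =
      ≤-antisym (incSubseq-length≤ s) (subst (_≤ length ps) length-qs (longest qs t))

  module _ (fw : Fireworks w) {r : Fin n → ℕ} (rc : IsRajcode w r) where

    rajcode-last : ∀ i → n ≤ suc (toℕ i) → r i ≡ 0
    rajcode-last i n≤si = trans (rajcode≡nonAscentsFrom fw rc i) (nonAscentsFrom-last n≤si)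

    module _ {i j : Fin n} (j≡si : toℕ j ≡ suc (toℕ i)) where

      private
        si<n : suc (toℕ i) < n
        si<n = subst (_< n) j≡si (toℕ<n j)

        rj≡ : r j ≡ nonAscentsFrom (suc (toℕ i))
        rj≡ = trans (rajcode≡nonAscentsFrom fw rc j) (cong nonAscentsFrom j≡si)

      rajcode-ascent : toℕ (w ⟨$⟩ʳ i) < toℕ (w ⟨$⟩ʳ j) → r i ≡ r j
      rajcode-ascent wi<wj = begin
        r i                            ≡⟨ rajcode≡nonAscentsFrom fw rc i ⟩
        nonAscentsFrom (toℕ i)         ≡⟨ nonAscentsFrom-ascent si<n asc ⟩
        nonAscentsFrom (suc (toℕ i))   ≡⟨ sym rj≡ ⟩
        r j                            ∎
        where
        open ≡-Reasoning
        asc : Ascent (toℕ i)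
        asc = subst₂ _<_ (sym (value-toℕ i)) (sym (value-next j≡si)) wi<wj

      rajcode-descent : toℕ (w ⟨$⟩ʳ j) < toℕ (w ⟨$⟩ʳ i) → r i ≡ suc (r j)
      rajcode-descent wj<wi = begin
        r i                                  ≡⟨ rajcode≡nonAscentsFrom fw rc i ⟩
        nonAscentsFrom (toℕ i)               ≡⟨ nonAscentsFrom-¬ascent si<n ¬asc ⟩
        suc (nonAscentsFrom (suc (toℕ i)))   ≡⟨ cong suc (sym rj≡) ⟩
        suc (r j)                            ∎
        where
        open ≡-Reasoning
        ¬asc : ¬ Ascent (toℕ i)
        ¬asc = <-asym (subst₂ _<_ (sym (value-next j≡si)) (sym (value-toℕ i)) wj<wi)

open import Data.Fin using (_<_)

lemma3p12 : ∀ (n : ℕ) (w : Permutation′ n) → Fireworks w →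
            ∀ (r : Fin n → ℕ) → IsRajcode w r →
            (∀ (i : Fin n) → toℕ i ≡ n ∸ 1 → r i ≡ 0)
            × (∀ (i j : Fin n) → toℕ j ≡ suc (toℕ i) →
                 ((w ⟨$⟩ʳ i) < (w ⟨$⟩ʳ j) → r i ≡ r j)
                 × ((w ⟨$⟩ʳ j) < (w ⟨$⟩ʳ i) → r i ≡ suc (r j)))
lemma3p12 n w fw r rc =
  (λ i i≡n-1 → rajcode-last w fw rc i (subst (λ k → n ≤ suc k) (sym i≡n-1) (m≤n+m∸n n 1))) ,
  (λ i j j≡si → rajcode-ascent w fw rc j≡si , rajcode-descent w fw rc j≡si)
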